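{- Let $G$ be a finite simple graph. The following are equivalent: (1) $G$ admits an orientation in which every vertex is near-transitive; (2) $G$ admits an acyclic orientation in which every vertex is near-transitive; (3) the induced subgraph $G_B$ of $G$ on its set of benjamins is a comparability graph.
   Context: An orientation of $G$ assigns each edge one direction. In an orientation, a vertex $t$ is transitive if for all vertices $a,b$, $t\to a\to b$ implies $t\to b$; a vertex $v$ is near-transitive if there exists a transitive vertex $t$ with $N[t]\subseteq N[v]$, where $N[u]$ denotes the closed neighbourhood of $u$ in $G$. A vertex $m$ is a benjamin of $G$ if there is no vertex $v$ with $N[v]\subsetneq N[m]$. A comparability graph is a graph admitting a transitive orientation (one in which every vertex is transitive). -}

module Defs where

open import Level using (0ℓ)
open import Data.Nat using (ℕ)
open import Data.Fin using (Fin)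
open import Data.Product using (Σ; _×_; _,_; proj₁; ∃)
open import Data.Sum using (_⊎_)
open import Relation.Nullary using (¬_)
open import Relation.Binary.PropositionalEquality using (_≡_)
open import Relation.Binary.Construct.Closure.Transitive using (TransClosure)
open import Relation.Nullary using (Dec)

record SimpleGraph (V : Set) : Set₁ where
  field
    Adj   : V → V → Set
    sym   : ∀ {u v} → Adj u v → Adj v u
    irrefl : ∀ {v} → ¬ Adj v v
    adj?   : ∀ u v → Dec (Adj u v)

FiniteSimpleGraph : ℕ → Set₁
FiniteSimpleGraph n = SimpleGraph (Fin n)

module _ {V : Set} (G : SimpleGraph V) where
  open SimpleGraph G

  record IsOrientation (_⇒_ : V → V → Set) : Set where
    field
      onEdges : ∀ {u v} → u ⇒ v → Adj u v
      total   : ∀ {u v} → Adj u v → (u ⇒ v) ⊎ (v ⇒ u)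
      asym    : ∀ {u v} → u ⇒ v → ¬ (v ⇒ u)

  Orientation : Set₁
  Orientation = Σ (V → V → Set) IsOrientation

  InN : V → V → Set
  InN u w = (w ≡ u) ⊎ Adj u w

  _⊆N_ : V → V → Set
  u ⊆N v = ∀ w → InN u w → InN v w

  _⊊N_ : V → V → Set
  u ⊊N v = (u ⊆N v) × ¬ (v ⊆N u)

  IsBenjamin : V → Set
  IsBenjamin m = ¬ (∃ λ v → v ⊊N m)

  module _ (O : Orientation) where
    private
      _⇒_ = proj₁ O

    IsTransitiveVertex : V → Set
    IsTransitiveVertex t = ∀ a b → t ⇒ a → a ⇒ b → t ⇒ b

    IsNearTransitive : V → Set
    IsNearTransitive v = ∃ λ t → IsTransitiveVertex t × (t ⊆N v)

    IsAcyclic : Set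
    IsAcyclic = ∀ v → ¬ TransClosure _⇒_ v v

    IsTransitiveOrientation : Set
    IsTransitiveOrientation = ∀ t → IsTransitiveVertex t

  IsComparabilityGraph : Set₁
  IsComparabilityGraph = ∃ λ (O : Orientation) → IsTransitiveOrientation O

induced : {V : Set} → SimpleGraph V → (P : V → Set) → SimpleGraph (Σ V P)
induced G P = record
  { Adj = λ u v → SimpleGraph.Adj G (proj₁ u) (proj₁ v)
  ; sym = SimpleGraph.sym G
  ; irrefl = SimpleGraph.irrefl G
  ; adj? = λ u v → SimpleGraph.adj? G (proj₁ u) (proj₁ v)
  }

benjaminSubgraph : {V : Set} (G : SimpleGraph V) → SimpleGraph (Σ V (IsBenjamin G))
benjaminSubgraph G = induced G (IsBenjamin G)

{-# OPTIONS --safe #-}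
-- Every vertex v lies above a benjamin m, i.e. N[m] ⊆ N[v], because strict
-- inclusion of closed neighbourhoods is a strict partial order on a finite set;
-- and a near-transitivity witness t of a benjamin m is a closed twin of it,
-- since N[t] ⊆ N[m] cannot be strict.
--
-- (1) ⇒ (3): orient G_B by comparing the chosen witnesses of the endpoints and
-- break ties by vertex index.  Distinct witnesses of adjacent benjamins are
-- adjacent (they are twins of the endpoints), and the orientation is
-- transitive because every witness is a transitive vertex.
--
-- (3) ⇒ (2): put the non-benjamins first, ordered by index, and the benjamins
-- after them, ordered by the transitive orientation of G_B.  This is a strict
-- order, so the orientation is acyclic; every out-neighbour of a benjamin is a
-- benjamin, so benjamins are transitive, and every vertex is near-transitive
-- through a benjamin below it.
module Submission where

open import Defs
open import Data.Nat using (ℕ)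
open import Data.Product using (Σ; _×_; ∃; _,_; proj₁; proj₂)
open import Function.Bundles using (_⇔_; mk⇔)

open import Level using (0ℓ)
open import Data.Empty using (⊥-elim)
open import Data.Fin using (Fin; _<_)
open import Data.Fin.Induction using (spo-wellFounded)
open import Data.Fin.Properties using (_≟_; <-cmp; <-trans; <-asym; all?; any?)
open import Data.Product.Relation.Binary.Lex.Strict using (×-Lex; ×-asymmetric)
open import Data.Sum as Sum using (_⊎_; inj₁; inj₂)
open import Data.Sum.Relation.Binary.LeftOrder
  using (_⊎-<_; ₁∼₂; ₁∼₁; ₂∼₂; ⊎-<-transitive; ⊎-<-asymmetric)
open import Function using (_∘_)
open import Induction.WellFounded using (Acc; acc)
open import Relation.Binary using (Rel; IsStrictPartialOrder; tri<; tri≈; tri>)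
open import Relation.Binary.Construct.Closure.Transitive using (TransClosure; [_]; _∷_)
open import Relation.Binary.PropositionalEquality
  using (_≡_; _≢_; refl; sym; trans; subst; resp₂; isEquivalence)
open import Relation.Nullary using (¬_; Dec; yes; no)
open import Relation.Nullary.Decidable using (_×-dec_; _→-dec_; _⊎-dec_; ¬?; decidable-stable)
open import Relation.Unary using (Pred; Decidable)

≢⇒<⊎> : ∀ {n} {i j : Fin n} → i ≢ j → i < j ⊎ j < i
≢⇒<⊎> {i = i} {j} i≢j with <-cmp i j
... | tri< i<j _ _ = inj₁ i<j
... | tri≈ _ i≡j _ = ⊥-elim (i≢j i≡j)
... | tri> _ _ j<i = inj₂ j<i

module _ {V : Set} (G : SimpleGraph V) where
  open SimpleGraph G using (Adj; irrefl) renaming (sym to Adj-sym)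

  private
    _⊆_ = _⊆N_ G

  ⊆N-refl : ∀ {u} → u ⊆ u
  ⊆N-refl w w∈N[u] = w∈N[u]

  ⊆N-trans : ∀ {u v w} → u ⊆ v → v ⊆ w → u ⊆ w
  ⊆N-trans u⊆v v⊆w x x∈N[u] = v⊆w x (u⊆v x x∈N[u])

  ⊊N-isStrictPartialOrder : IsStrictPartialOrder _≡_ (_⊊N_ G)
  ⊊N-isStrictPartialOrder = record
    { isEquivalence = isEquivalence
    ; irrefl = λ { refl (_ , u⊉u) → u⊉u ⊆N-refl }
    ; trans = λ (u⊆v , v⊈u) (v⊆w , w⊈v) → ⊆N-trans u⊆v v⊆w , λ w⊆u → w⊈v (⊆N-trans w⊆u u⊆v)
    ; <-resp-≈ = resp₂ (_⊊N_ G)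
    }

  InN-sym : ∀ {u w} → InN G u w → InN G w u
  InN-sym (inj₁ refl) = inj₁ refl
  InN-sym (inj₂ u~w) = inj₂ (Adj-sym u~w)

  Adj⇒≢ : ∀ {u v} → Adj u v → u ≢ v
  Adj⇒≢ u~v refl = irrefl u~v

  Adj-of-⊆N : ∀ {a a′ c c′} → a′ ⊆ a → c′ ⊆ c → InN G a′ c′ → a ≢ c → Adj a c
  Adj-of-⊆N {a} a′⊆a c′⊆c c′∈N[a′] a≢c with c′⊆c a (InN-sym (a′⊆a _ c′∈N[a′]))
  ... | inj₁ a≡c = ⊥-elim (a≢c a≡c)
  ... | inj₂ c~a = Adj-sym c~a

module _ {n : ℕ} (G : FiniteSimpleGraph n) where
  open SimpleGraph G using (Adj; adj?) renaming (sym to Adj-sym)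

  private
    _⊆_ = _⊆N_ G

  InN? : ∀ u w → Dec (InN G u w)
  InN? u w = (w ≟ u) ⊎-dec adj? u w

  ⊆N? : ∀ u v → Dec (u ⊆ v)
  ⊆N? u v = all? λ w → InN? u w →-dec InN? v w

  isBenjamin? : Decidable (IsBenjamin G)
  isBenjamin? m = ¬? (any? λ v → ⊆N? v m ×-dec ¬? (⊆N? m v))

  benjamin-⊆N-minimal : ∀ {m t} → IsBenjamin G m → t ⊆ m → m ⊆ t
  benjamin-⊆N-minimal {m} {t} benj t⊆m =
    decidable-stable (⊆N? m t) λ m⊈t → benj (t , t⊆m , m⊈t)

  benjamin-below : ∀ v → ∃ λ m → IsBenjamin G m × m ⊆ v
  benjamin-below v = descend (spo-wellFounded (⊊N-isStrictPartialOrder G) v)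
    where
    descend : ∀ {v} → Acc (_⊊N_ G) v → ∃ λ m → IsBenjamin G m × m ⊆ v
    descend {v} (acc below) with any? (λ u → ⊆N? u v ×-dec ¬? (⊆N? v u))
    ... | no benj = v , benj , ⊆N-refl G
    ... | yes (u , u⊊v) with descend (below u⊊v)
    ...   | m , benj , m⊆u = m , benj , ⊆N-trans G m⊆u (proj₁ u⊊v)

  module _ (O : Orientation G) (nearTransitive : ∀ v → IsNearTransitive G O v) where
    private
      _⇒_ = proj₁ O
      module O = IsOrientation (proj₂ O)

      rep : Fin n → Fin n
      rep v = proj₁ (nearTransitive v)

      rep-transitive : ∀ v → IsTransitiveVertex G O (rep v)
      rep-transitive v = proj₁ (proj₂ (nearTransitive v))

      rep-⊆ : ∀ v → rep v ⊆ v
      rep-⊆ v = proj₂ (proj₂ (nearTransitive v))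

      _⊏_ : Rel (Fin n) 0ℓ
      a ⊏ b = ×-Lex _≡_ _⇒_ _<_ (rep a , a) (rep b , b)

      ⊏-asym : ∀ {a b} → a ⊏ b → ¬ b ⊏ a
      ⊏-asym {a} {b} =
        ×-asymmetric {_<₂_ = _<_} sym (resp₂ _⇒_) O.asym <-asym {rep a , a} {rep b , b}

      ⊏-trans : ∀ {a b c} → a ⊏ b → b ⊏ c → a ⊏ c
      ⊏-trans {a} (inj₁ ra⇒rb) (inj₁ rb⇒rc) = inj₁ (rep-transitive a _ _ ra⇒rb rb⇒rc)
      ⊏-trans {a} (inj₁ ra⇒rb) (inj₂ (rb≡rc , _)) = inj₁ (subst (rep a ⇒_) rb≡rc ra⇒rb)
      ⊏-trans {c = c} (inj₂ (ra≡rb , _)) (inj₁ rb⇒rc) =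
        inj₁ (subst (_⇒ rep c) (sym ra≡rb) rb⇒rc)
      ⊏-trans (inj₂ (ra≡rb , a<b)) (inj₂ (rb≡rc , b<c)) =
        inj₂ (trans ra≡rb rb≡rc , <-trans a<b b<c)

      ⊏⇒Adj : ∀ {a b} → a ⊏ b → Adj a b
      ⊏⇒Adj {a} {b} a⊏b =
        Adj-of-⊆N G (rep-⊆ a) (rep-⊆ b) (reps-close a⊏b) λ { refl → ⊏-asym a⊏b a⊏b }
        where
        reps-close : a ⊏ b → InN G (rep a) (rep b)
        reps-close (inj₁ ra⇒rb) = inj₂ (O.onEdges ra⇒rb)
        reps-close (inj₂ (ra≡rb , _)) = inj₁ (sym ra≡rb)

      ⊏-total : ∀ {a b} → a ⊆ rep a → b ⊆ rep b → Adj a b → a ⊏ b ⊎ b ⊏ a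
      ⊏-total {a} {b} a⊆ra b⊆rb a~b with rep a ≟ rep b
      ... | yes ra≡rb = Sum.map (λ a<b → inj₂ (ra≡rb , a<b)) (λ b<a → inj₂ (sym ra≡rb , b<a))
                                (≢⇒<⊎> (Adj⇒≢ G a~b))
      ... | no ra≢rb = Sum.map inj₁ inj₁ (O.total (Adj-of-⊆N G a⊆ra b⊆rb (inj₂ a~b) ra≢rb))

    nearTransitive⇒comparability : {S : Pred (Fin n) 0ℓ} →
                                   (∀ {a t} → S a → t ⊆ a → a ⊆ t) →
                                   IsComparabilityGraph (induced G S)
    nearTransitive⇒comparability {S} S-minimal = (_⇒ₛ_ , isOrientation) , λ _ _ _ → ⊏-trans
      where
      _⇒ₛ_ : Rel (Σ (Fin n) S) 0ℓ
      (a , _) ⇒ₛ (b , _) = a ⊏ b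

      isOrientation : IsOrientation (induced G S) _⇒ₛ_
      isOrientation = record
        { onEdges = ⊏⇒Adj
        ; total = λ { {a , sa} {b , sb} →
                      ⊏-total (S-minimal sa (rep-⊆ a)) (S-minimal sb (rep-⊆ b)) }
        ; asym = ⊏-asym
        }

  module _ {S : Pred (Fin n) 0ℓ} (S? : Decidable S) (OS : Orientation (induced G S))
           (OS-transitive : IsTransitiveOrientation (induced G S) OS) where
    private
      _⇒ₛ_ = proj₁ OS
      module OS = IsOrientation (proj₂ OS)

      _<ᵢ_ : Rel (Σ (Fin n) (¬_ ∘ S)) 0ℓ
      (a , _) <ᵢ (b , _) = a < b

      _≺ₛ_ = _<ᵢ_ ⊎-< _⇒ₛ_

      side : ∀ {a} → Dec (S a) → Σ (Fin n) (¬_ ∘ S) ⊎ Σ (Fin n) S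
      side {a} (yes sa) = inj₂ (a , sa)
      side {a} (no ¬sa) = inj₁ (a , ¬sa)

      -- S comes last, so that every out-neighbour of a vertex of S lies in S.
      _≺_ : Rel (Fin n) 0ℓ
      a ≺ b = side (S? a) ≺ₛ side (S? b)

      ≺-trans : ∀ {a b c} → a ≺ b → b ≺ c → a ≺ c
      ≺-trans = ⊎-<-transitive <-trans (OS-transitive _ _ _)

      ≺-asym : ∀ {a b} → a ≺ b → ¬ b ≺ a
      ≺-asym = ⊎-<-asymmetric <-asym OS.asym

      ≺-total : ∀ {a b} → Adj a b → a ≺ b ⊎ b ≺ a
      ≺-total {a} {b} a~b = compare (S? a) (S? b)
        where
        compare : (da : Dec (S a)) (db : Dec (S b)) → side da ≺ₛ side db ⊎ side db ≺ₛ side da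
        compare (yes _) (yes _) = Sum.map ₂∼₂ ₂∼₂ (OS.total a~b)
        compare (yes _) (no _) = inj₂ ₁∼₂
        compare (no _) (yes _) = inj₁ ₁∼₂
        compare (no _) (no _) = Sum.map ₁∼₁ ₁∼₁ (≢⇒<⊎> (Adj⇒≢ G a~b))

      ≺⇒Adj : ∀ {t b} → S t → t ≺ b → Adj t b
      ≺⇒Adj {t} {b} st = from (S? t) (S? b)
        where
        from : (dt : Dec (S t)) (db : Dec (S b)) → side dt ≺ₛ side db → Adj t b
        from (yes _) (yes _) (₂∼₂ t⇒b) = OS.onEdges t⇒b
        from (yes _) (no _) ()
        from (no ¬st) _ _ = ⊥-elim (¬st st)

    extendTransitiveOrientation :
      ∃ λ (O : Orientation G) → IsAcyclic G O × (∀ t → S t → IsTransitiveVertex G O t)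
    extendTransitiveOrientation = (_⇒_ , isOrientation) , acyclic , S-transitive
      where
      _⇒_ : Rel (Fin n) 0ℓ
      a ⇒ b = Adj a b × a ≺ b

      isOrientation : IsOrientation G _⇒_
      isOrientation = record
        { onEdges = proj₁
        ; total = λ a~b → Sum.map (a~b ,_) (Adj-sym a~b ,_) (≺-total a~b)
        ; asym = λ (_ , a≺b) (_ , b≺a) → ≺-asym a≺b b≺a
        }

      ⇒⁺⇒≺ : ∀ {a b} → TransClosure _⇒_ a b → a ≺ b
      ⇒⁺⇒≺ [ a⇒b ] = proj₂ a⇒b
      ⇒⁺⇒≺ (a⇒b ∷ b⇒⁺c) = ≺-trans (proj₂ a⇒b) (⇒⁺⇒≺ b⇒⁺c)

      acyclic : IsAcyclic G (_⇒_ , isOrientation)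
      acyclic v v⇒⁺v = ≺-asym (⇒⁺⇒≺ v⇒⁺v) (⇒⁺⇒≺ v⇒⁺v)

      S-transitive : ∀ t → S t → IsTransitiveVertex G (_⇒_ , isOrientation) t
      S-transitive t st a b (_ , t≺a) (_ , a≺b) = ≺⇒Adj st t≺b , t≺b
        where
        t≺b = ≺-trans t≺a a≺b

theorem6p2 : (n : ℕ) (G : FiniteSimpleGraph n) →
    ((∃ λ (O : Orientation G) → ∀ v → IsNearTransitive G O v)
    ⇔ (∃ λ (O : Orientation G) → IsAcyclic G O × (∀ v → IsNearTransitive G O v)))
    × ((∃ λ (O : Orientation G) → ∀ v → IsNearTransitive G O v)
    ⇔ IsComparabilityGraph (benjaminSubgraph G))
theorem6p2 n G = mk⇔ (two⇐three ∘ three⇐one) one⇐two , mk⇔ three⇐one (one⇐two ∘ two⇐three)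
  where
  three⇐one : (∃ λ O → ∀ v → IsNearTransitive G O v) → IsComparabilityGraph (benjaminSubgraph G)
  three⇐one (O , nearTransitive) =
    nearTransitive⇒comparability G O nearTransitive (benjamin-⊆N-minimal G)

  two⇐three : IsComparabilityGraph (benjaminSubgraph G) →
              ∃ λ O → IsAcyclic G O × (∀ v → IsNearTransitive G O v)
  two⇐three (OB , OB-transitive)
    with extendTransitiveOrientation G (isBenjamin? G) OB OB-transitive
  ... | O , acyclic , benjamin-transitive = O , acyclic , nearTransitive
    where
    nearTransitive : ∀ v → IsNearTransitive G O v
    nearTransitive v with benjamin-below G v
    ... | m , benj , m⊆v = m , benjamin-transitive m benj , m⊆v

  one⇐two : (∃ λ O → IsAcyclic G O × (∀ v → IsNearTransitive G O v)) →
            ∃ λ O → ∀ v → IsNearTransitive G O v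
  one⇐two (O , _ , nearTransitive) = O , nearTransitive
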